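{- Let $k\ge2$. For every integer $m\ge1$, \[D(m,k)=G(m+1,k)-G(m,k)=a\big(d_0(m,k),k\big).\]
   Context: Fix an integer $k\ge 2$. Let $T_k$ be the infinite rooted $k$-ary tree (every vertex has exactly $k$ children) with one additional self-loop at the root, so every vertex has degree $k+1$. Chip-firing: a vertex with at least $k+1$ chips may fire, sending one chip along each incident edge (a non-root vertex sends one chip to its parent and one to each of its $k$ children; the root sends one chip to each of its $k$ children and one chip to itself along the self-loop). Starting with $N\ge0$ chips at the root and none elsewhere, vertices fire until no vertex can fire; this terminates, and the number of times each vertex fires does not depend on the order of firings. $f_0(N,k)$ denotes the number of root fires and $F(N,k)$ the total number of fires summed over all vertices (both $0$ for $N=0$). For integers $m\ge0$ define $g_0(m,k)=f_0(mk,k)$, $d_0(m,k)=g_0(m+1,k)-g_0(m,k)$, $G(m,k)=F(mk,k)$ and $D(m,k)=G(m+1,k)-G(m,k)$. The sequence $a(n,k)$ is defined by $a(1,k)=1$ and $a(n,k)=k\,a(n-1,k)+n$ for $n\ge2$. -}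

module Defs where

open import Data.Nat using (ℕ; zero; suc; _+_; _*_; _∸_; _≤_; _<_)
open import Data.Fin using (Fin)
import Data.Fin.Properties as FinP
open import Data.List using (List; []; _∷_; length)
import Data.List.Properties as ListP
open import Relation.Nullary using (yes; no)
open import Relation.Binary.PropositionalEquality using (_≡_)

-- Vertices of the infinite rooted k-ary tree T_k: a vertex is the path from the
-- root, written innermost-first.  The root is [], the children of v are  i ∷ v
-- (i : Fin k), and the parent of  i ∷ v  is v.
Vertex : ℕ → Set
Vertex k = List (Fin k)

_≟V_ : {k : ℕ} → (v w : Vertex k) → Relation.Nullary.Dec (v ≡ w)
_≟V_ = ListP.≡-dec FinP._≟_

Config : ℕ → Set
Config k = Vertex k → ℕ

[_≡?_] : {k : ℕ} → Vertex k → Vertex k → ℕ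
[ v ≡? w ] with v ≟V w
... | yes _ = 1
... | no  _ = 0

parentIs : {k : ℕ} → Vertex k → Vertex k → ℕ
parentIs []      w = 0
parentIs (_ ∷ v) w = [ v ≡? w ]

loopAt : {k : ℕ} → Vertex k → Vertex k → ℕ
loopAt []      []      = 1
loopAt []      (_ ∷ _) = 0
loopAt (_ ∷ _) _       = 0

-- number of chips sent from v to w when v fires (= number of edges between v and w,
-- the root's self-loop counting once)
edges : {k : ℕ} → Vertex k → Vertex k → ℕ
edges v w = parentIs w v + parentIs v w + loopAt v w

out : (k : ℕ) → Vertex k → Vertex k → ℕ
out k v w with w ≟V v
... | yes _ = suc k
... | no  _ = 0

-- firing vertex v (every vertex has degree k+1)
fire : (k : ℕ) → Vertex k → Config k → Config k
fire k v c w = (c w + edges v w) ∸ out k v w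

data LegalRun (k : ℕ) : Config k → List (Vertex k) → Config k → Set where
  done : ∀ {c} → LegalRun k c [] c
  step : ∀ {c c' v vs} → suc k ≤ c v → LegalRun k (fire k v c) vs c' →
         LegalRun k c (v ∷ vs) c'

Stable : (k : ℕ) → Config k → Set
Stable k c = ∀ v → c v < suc k

initial : (k : ℕ) → ℕ → Config k
initial k N []      = N
initial k N (_ ∷ _) = 0

rootFires : {k : ℕ} → List (Vertex k) → ℕ
rootFires []            = 0
rootFires ([] ∷ s)      = suc (rootFires s)
rootFires ((_ ∷ _) ∷ s) = rootFires s

-- a(n,k): a(1,k)=1, a(n,k)=k a(n-1,k)+n; extended by a(0,k)=0 (consistent with the recursion)
a : ℕ → ℕ → ℕ
a zero    k = 0
a (suc n) k = k * a n k + suc n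

-- By the least action principle, every stabilizing run from a given configuration fires each
-- vertex equally often, so it suffices to exhibit one stabilizing run for each number of chips.
-- Write m in bijective base k, m = Σᵢ dᵢ kⁱ with 1 ≤ dᵢ ≤ k. From (m+1)k chips at the root one
-- reaches the stable configuration with k chips at the root and dᵢ chips at every vertex of
-- level i+1. Add k more chips at the root and let n − 1 be the number of leading digits equal
-- to k. Then the waves n−1, …, 1, 0 fire legally, where wave j fires all of level 0, then all of
-- level 1, …, then all of level j; they turn those n − 1 digits into 1 and raise the next one,
-- which yields the stable configuration for m + 1. The root fires once per wave, so d₀ = n, and
-- wave j fires 1 + k + ⋯ + kʲ vertices; summing over j < n gives a(n, k).

module Submission where

open import Defs
open import Data.Empty using (⊥-elim)
open import Data.Fin using (Fin; zero; suc)
import Data.Fin.Properties as Fin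
open import Data.List using (List; []; _∷_; [_]; _++_; map; concatMap; length; tabulate; allFin; upTo; downFrom)
open import Data.List.Membership.Propositional using (_∈_)
open import Data.List.Membership.Propositional.Properties using (∈-∃++)
open import Data.List.Properties
  using (map-++; map-cong; map-∘; map-tabulate; length-tabulate; length-++; ++-assoc; ++-identityʳ; upTo-∷ʳ; ∷-injectiveˡ; ∷-injectiveʳ)
open import Data.List.Relation.Unary.All using (All; []; _∷_)
open import Data.List.Relation.Unary.Any using (here; there)
open import Data.Nat using (ℕ; zero; suc; _+_; _*_; _∸_; _^_; _≤_; _<_; z≤n; s≤s; _≟_)
open import Data.Nat.ListAction using (sum)
open import Data.Nat.ListAction.Properties using (sum-++)
open import Data.Nat.Properties
open import Algebra.Properties.CommutativeSemigroup +-commutativeSemigroup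
  using (x∙yz≈y∙xz; x∙yz≈yx∙z; x∙yz≈xz∙y; xy∙z≈x∙zy; xy∙z≈xz∙y; interchange)
open import Data.Nat.Tactic.RingSolver using (solve-∀)
open import Data.Product using (∃; ∃₂; _×_; _,_)
open import Function using (id; _∘_)
open import Relation.Nullary using (Dec; yes; no)
open import Relation.Binary.PropositionalEquality hiding ([_])

private
  variable
    A B : Set

sum-map-++ : (f : A → ℕ) (xs ys : List A) →
             sum (map f (xs ++ ys)) ≡ sum (map f xs) + sum (map f ys)
sum-map-++ f xs ys = trans (cong sum (map-++ f xs ys)) (sum-++ (map f xs) (map f ys))

sum-map-++-∷ : (f : A → ℕ) (xs : List A) (y : A) (ys : List A) →
               sum (map f (xs ++ y ∷ ys)) ≡ f y + sum (map f (xs ++ ys))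
sum-map-++-∷ f xs y ys = begin
  sum (map f (xs ++ y ∷ ys))                ≡⟨ sum-map-++ f xs (y ∷ ys) ⟩
  sum (map f xs) + (f y + sum (map f ys))   ≡⟨ x∙yz≈y∙xz (sum (map f xs)) (f y) _ ⟩
  f y + (sum (map f xs) + sum (map f ys))   ≡⟨ cong (f y +_) (sum-map-++ f xs ys) ⟨
  f y + sum (map f (xs ++ ys))              ∎
  where open ≡-Reasoning

sum-map-cong : {f g : A → ℕ} → (∀ x → f x ≡ g x) → (xs : List A) → sum (map f xs) ≡ sum (map g xs)
sum-map-cong f≗g xs = cong sum (map-cong f≗g xs)

sum-map-zero : {f : A → ℕ} → (∀ x → f x ≡ 0) → (xs : List A) → sum (map f xs) ≡ 0
sum-map-zero f≗0 []       = refl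
sum-map-zero f≗0 (x ∷ xs) = cong₂ _+_ (f≗0 x) (sum-map-zero f≗0 xs)

sum-map-const : (c : ℕ) (xs : List A) → sum (map (λ _ → c) xs) ≡ length xs * c
sum-map-const c []       = refl
sum-map-const c (x ∷ xs) = cong (c +_) (sum-map-const c xs)

length≡sum-map-1 : (xs : List A) → length xs ≡ sum (map (λ _ → 1) xs)
length≡sum-map-1 xs = sym (trans (sum-map-const 1 xs) (*-identityʳ (length xs)))

sum-map-+ : (f g : A → ℕ) (xs : List A) →
            sum (map (λ x → f x + g x) xs) ≡ sum (map f xs) + sum (map g xs)
sum-map-+ f g []       = refl
sum-map-+ f g (x ∷ xs) =
  trans (cong (f x + g x +_) (sum-map-+ f g xs)) (interchange (f x) (g x) _ _)

sum-map-concatMap : (f : B → ℕ) (g : A → List B) (xs : List A) →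
                    sum (map f (concatMap g xs)) ≡ sum (map (λ x → sum (map f (g x))) xs)
sum-map-concatMap f g []       = refl
sum-map-concatMap f g (x ∷ xs) =
  trans (sum-map-++ f (g x) (concatMap g xs)) (cong (sum (map f (g x)) +_) (sum-map-concatMap f g xs))

sum-tabulate-single : ∀ {n} (f : Fin n → ℕ) (i₀ : Fin n) → (∀ i → i ≢ i₀ → f i ≡ 0) →
                      sum (tabulate f) ≡ f i₀
sum-tabulate-single f zero     off = begin
  f zero + sum (tabulate (f ∘ suc))          ≡⟨ cong (f zero +_) (cong sum (map-tabulate id (f ∘ suc))) ⟨
  f zero + sum (map (f ∘ suc) (allFin _))    ≡⟨ cong (f zero +_) (sum-map-zero (λ i → off (suc i) λ ()) (allFin _)) ⟩
  f zero + 0                                 ≡⟨ +-identityʳ (f zero) ⟩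
  f zero                                     ∎
  where open ≡-Reasoning
sum-tabulate-single f (suc i₀) off =
  trans (cong (_+ sum (tabulate (f ∘ suc))) (off zero λ ()))
        (sum-tabulate-single (f ∘ suc) i₀ (λ i i≢i₀ → off (suc i) (i≢i₀ ∘ Fin.suc-injective)))

sum-map-allFin-single : ∀ {n} (f : Fin n → ℕ) (i₀ : Fin n) → (∀ i → i ≢ i₀ → f i ≡ 0) →
                        sum (map f (allFin n)) ≡ f i₀
sum-map-allFin-single f i₀ off = trans (cong sum (map-tabulate id f)) (sum-tabulate-single f i₀ off)

δ : ℕ → ℕ → ℕ
δ zero    zero    = 1
δ zero    (suc _) = 0
δ (suc _) zero    = 0
δ (suc i) (suc j) = δ i j

δ-refl : ∀ i → δ i i ≡ 1
δ-refl zero    = refl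
δ-refl (suc i) = δ-refl i

δ-≢ : ∀ {i j} → i ≢ j → δ i j ≡ 0
δ-≢ {zero}  {zero}  i≢j = ⊥-elim (i≢j refl)
δ-≢ {zero}  {suc j} _   = refl
δ-≢ {suc i} {zero}  _   = refl
δ-≢ {suc i} {suc j} i≢j = δ-≢ (i≢j ∘ cong suc)

δ-≤1 : ∀ i j → δ i j ≤ 1
δ-≤1 zero    zero    = ≤-refl
δ-≤1 zero    (suc j) = z≤n
δ-≤1 (suc i) zero    = z≤n
δ-≤1 (suc i) (suc j) = δ-≤1 i j

δ-pos⇒≡ : ∀ {i j} → 1 ≤ δ i j → i ≡ j
δ-pos⇒≡ {zero}  {zero}  _   = refl
δ-pos⇒≡ {suc i} {suc j} pos = cong suc (δ-pos⇒≡ pos)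

below : ℕ → ℕ → ℕ
below _       zero    = 0
below zero    (suc _) = 1
below (suc i) (suc n) = below i n

parentBelow : ℕ → ℕ → ℕ
parentBelow zero    _ = 0
parentBelow (suc i) n = below i n

below-suc : ∀ i n → below i (suc n) ≡ below i n + δ i n
below-suc zero    zero    = refl
below-suc zero    (suc n) = refl
below-suc (suc i) zero    = refl
below-suc (suc i) (suc n) = below-suc i n

parentBelow-suc : ∀ i n → parentBelow i (suc n) ≡ parentBelow i n + δ i (suc n)
parentBelow-suc zero    n = refl
parentBelow-suc (suc i) n = below-suc i n

-- Chip-firing on T_k

module _ {k : ℕ} where

  [≡?]-refl : (v : Vertex k) → [ v ≡? v ] ≡ 1
  [≡?]-refl v with v ≟V v
  ... | yes _   = refl
  ... | no v≢v = ⊥-elim (v≢v refl)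

  [≡?]-≢ : {v w : Vertex k} → v ≢ w → [ v ≡? w ] ≡ 0
  [≡?]-≢ {v} {w} v≢w with v ≟V w
  ... | yes v≡w = ⊥-elim (v≢w v≡w)
  ... | no _    = refl

  [≡?]-sym : (v w : Vertex k) → [ v ≡? w ] ≡ [ w ≡? v ]
  [≡?]-sym v w with v ≟V w
  ... | yes refl = sym ([≡?]-refl v)
  ... | no v≢w  = sym ([≡?]-≢ (v≢w ∘ sym))

  [≡?]-∷ : (i : Fin k) (u w : Vertex k) → [ i ∷ u ≡? i ∷ w ] ≡ [ u ≡? w ]
  [≡?]-∷ i u w = by-cases (u ≟V w)
    where
    by-cases : Dec (u ≡ w) → [ i ∷ u ≡? i ∷ w ] ≡ [ u ≡? w ]
    by-cases (yes refl) = trans ([≡?]-refl (i ∷ u)) (sym ([≡?]-refl u))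
    by-cases (no u≢w)   = trans ([≡?]-≢ (u≢w ∘ ∷-injectiveʳ)) (sym ([≡?]-≢ u≢w))

  [≡?]-∷-≢ : {i j : Fin k} (u w : Vertex k) → i ≢ j → [ i ∷ u ≡? j ∷ w ] ≡ 0
  [≡?]-∷-≢ u w i≢j = [≡?]-≢ (i≢j ∘ ∷-injectiveˡ)

  out≡ : (v w : Vertex k) → out k v w ≡ suc k * [ v ≡? w ]
  out≡ v w with w ≟V v
  ... | yes refl = sym (trans (cong (suc k *_) ([≡?]-refl v)) (*-identityʳ (suc k)))
  ... | no w≢v  = sym (trans (cong (suc k *_) ([≡?]-≢ (w≢v ∘ sym))) (*-zeroʳ (suc k)))

  out-≤ : ∀ {c : Config k} {v} → suc k ≤ c v → ∀ w → out k v w ≤ c w + edges v w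
  out-≤ {c} {v} v-ready w with w ≟V v
  ... | yes refl = ≤-trans v-ready (m≤m+n (c v) (edges v v))
  ... | no _     = z≤n

  fire-balance : ∀ {c : Config k} {v} → suc k ≤ c v →
                 ∀ w → fire k v c w + suc k * [ v ≡? w ] ≡ c w + edges v w
  fire-balance {c} {v} v-ready w =
    trans (cong (fire k v c w +_) (sym (out≡ v w))) (m∸n+n≡m (out-≤ {c} v-ready w))

  fire-+ : ∀ {c d e : Config k} {v} → suc k ≤ c v → (∀ w → d w ≡ c w + e w) →
           ∀ w → fire k v d w ≡ fire k v c w + e w
  fire-+ {c} {d} {e} {v} v-ready d≗c+e w = begin
    (d w + edges v w) ∸ out k v w          ≡⟨ cong (λ x → (x + edges v w) ∸ out k v w) (d≗c+e w) ⟩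
    (c w + e w + edges v w) ∸ out k v w    ≡⟨ cong (_∸ out k v w) (xy∙z≈xz∙y (c w) (e w) (edges v w)) ⟩
    (c w + edges v w + e w) ∸ out k v w    ≡⟨ +-∸-comm (e w) (out-≤ {c} v-ready w) ⟩
    fire k v c w + e w                     ∎
    where open ≡-Reasoning

  fire-nonadjacent : ∀ {c : Config k} {v w} → w ≢ v → edges v w ≡ 0 → fire k v c w ≡ c w
  fire-nonadjacent {c} {v} {w} w≢v no-edge
    rewrite no-edge | out≡ v w | [≡?]-≢ (w≢v ∘ sym) | *-zeroʳ k = +-identityʳ (c w)

  legal-++ : ∀ {c c₁ c₂ : Config k} {xs ys} →
             LegalRun k c xs c₁ → LegalRun k c₁ ys c₂ → LegalRun k c (xs ++ ys) c₂
  legal-++ done               run = run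
  legal-++ (step ready run₁) run₂ = step ready (legal-++ run₁ run₂)

  legal-+ : ∀ {c c' d e : Config k} {vs} → LegalRun k c vs c' → (∀ w → d w ≡ c w + e w) →
            ∃ λ d' → LegalRun k d vs d' × (∀ w → d' w ≡ c' w + e w)
  legal-+ {d = d} done d≗c+e = d , done , d≗c+e
  legal-+ {c} {e = e} (step {v = v} ready run) d≗c+e =
    let d' , run' , d'≗c'+e = legal-+ run (fire-+ ready d≗c+e)
    in  d' , step (≤-trans ready (≤-trans (m≤m+n (c v) (e v)) (≤-reflexive (sym (d≗c+e v))))) run' , d'≗c'+e

  occ : Vertex k → List (Vertex k) → ℕ
  occ w vs = sum (map (λ v → [ v ≡? w ]) vs)

  inflow : List (Vertex k) → Vertex k → ℕ
  inflow vs w = sum (map (λ v → edges v w) vs)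

  run-balance : ∀ {c c' : Config k} {vs} → LegalRun k c vs c' →
                ∀ w → c' w + suc k * occ w vs ≡ c w + inflow vs w
  run-balance {c} done w = cong (c w +_) (*-zeroʳ (suc k))
  run-balance {c} {c'} (step {v = v} {vs = vs} ready run) w = begin
    c' w + suc k * ([ v ≡? w ] + occ w vs)                   ≡⟨ cong (c' w +_) (*-distribˡ-+ (suc k) [ v ≡? w ] (occ w vs)) ⟩
    c' w + (suc k * [ v ≡? w ] + suc k * occ w vs)           ≡⟨ x∙yz≈y∙xz (c' w) (suc k * [ v ≡? w ]) _ ⟩
    suc k * [ v ≡? w ] + (c' w + suc k * occ w vs)           ≡⟨ cong (suc k * [ v ≡? w ] +_) (run-balance run w) ⟩
    suc k * [ v ≡? w ] + (fire k v c w + inflow vs w)        ≡⟨ x∙yz≈yx∙z (suc k * [ v ≡? w ]) (fire k v c w) _ ⟩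
    (fire k v c w + suc k * [ v ≡? w ]) + inflow vs w        ≡⟨ cong (_+ inflow vs w) (fire-balance {c} ready w) ⟩
    (c w + edges v w) + inflow vs w                          ≡⟨ +-assoc (c w) _ _ ⟩
    c w + (edges v w + inflow vs w)                          ∎
    where open ≡-Reasoning

  occ-∷-self : ∀ v vs → 1 ≤ occ v (v ∷ vs)
  occ-∷-self v vs = ≤-trans (≤-reflexive (sym ([≡?]-refl v))) (m≤m+n _ _)

  occ-pos⇒∈ : ∀ {v} vs → 1 ≤ occ v vs → v ∈ vs
  occ-pos⇒∈ {v} (u ∷ vs) pos = by-cases (u ≟V v)
    where
    by-cases : Dec (u ≡ v) → v ∈ u ∷ vs
    by-cases (yes refl) = here refl
    by-cases (no u≢v)   = there (occ-pos⇒∈ vs (subst (λ n → 1 ≤ n + occ v vs) ([≡?]-≢ u≢v) pos))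

  sum-map-mono-occ : (f : Vertex k → ℕ) (xs ys : List (Vertex k)) →
                     (∀ v → occ v xs ≤ occ v ys) → sum (map f xs) ≤ sum (map f ys)
  sum-map-mono-occ f []       ys xs≤ys = z≤n
  sum-map-mono-occ f (x ∷ xs) ys xs≤ys
    with ys₁ , ys₂ , refl ← ∈-∃++ (occ-pos⇒∈ ys (≤-trans (occ-∷-self x xs) (xs≤ys x))) = begin
      f x + sum (map f xs)            ≤⟨ +-monoʳ-≤ (f x) (sum-map-mono-occ f xs (ys₁ ++ ys₂) xs≤ys₁ys₂) ⟩
      f x + sum (map f (ys₁ ++ ys₂))  ≡⟨ sum-map-++-∷ f ys₁ x ys₂ ⟨
      sum (map f (ys₁ ++ x ∷ ys₂))    ∎
    where
    open ≤-Reasoning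
    xs≤ys₁ys₂ : ∀ v → occ v xs ≤ occ v (ys₁ ++ ys₂)
    xs≤ys₁ys₂ v = +-cancelˡ-≤ [ x ≡? v ] _ _
      (subst (occ v (x ∷ xs) ≤_) (sum-map-++-∷ (λ u → [ u ≡? v ]) ys₁ x ys₂) (xs≤ys v))

  length-mono-occ : (xs ys : List (Vertex k)) → (∀ v → occ v xs ≤ occ v ys) → length xs ≤ length ys
  length-mono-occ xs ys xs≤ys =
    subst₂ _≤_ (sym (length≡sum-map-1 xs)) (sym (length≡sum-map-1 ys)) (sum-map-mono-occ _ xs ys xs≤ys)

  rootFires≡occ-root : (vs : List (Vertex k)) → rootFires vs ≡ occ [] vs
  rootFires≡occ-root []            = refl
  rootFires≡occ-root ([] ∷ vs)     = cong suc (rootFires≡occ-root vs)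
  rootFires≡occ-root ((_ ∷ _) ∷ vs) = rootFires≡occ-root vs

  rootFires-++ : (xs ys : List (Vertex k)) → rootFires (xs ++ ys) ≡ rootFires xs + rootFires ys
  rootFires-++ xs ys = begin
    rootFires (xs ++ ys)            ≡⟨ rootFires≡occ-root (xs ++ ys) ⟩
    occ [] (xs ++ ys)               ≡⟨ sum-map-++ _ xs ys ⟩
    occ [] xs + occ [] ys           ≡⟨ cong₂ _+_ (rootFires≡occ-root xs) (rootFires≡occ-root ys) ⟨
    rootFires xs + rootFires ys     ∎
    where open ≡-Reasoning

  occ-snoc : ∀ vs u w → occ w (vs ++ [ u ]) ≡ occ w vs + [ u ≡? w ]
  occ-snoc vs u w = trans (sum-map-++ _ vs [ u ]) (cong (occ w vs +_) (+-identityʳ [ u ≡? w ]))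

  module _ {c₀ c∞ : Config k} {r : List (Vertex k)} (run-r : LegalRun k c₀ r c∞) (c∞-stable : Stable k c∞) where

    least-action-from : ∀ {c c' : Config k} {ps vs} → LegalRun k c₀ ps c → (∀ v → occ v ps ≤ occ v r) →
                        LegalRun k c vs c' → ∀ v → occ v (ps ++ vs) ≤ occ v r
    least-action-from {ps = ps} run-ps ps≤r done v =
      subst (λ xs → occ v xs ≤ occ v r) (sym (++-identityʳ ps)) (ps≤r v)
    least-action-from {c} {ps = ps} run-ps ps≤r (step {v = u} {vs = vs} u-ready run) v =
      subst (λ xs → occ v xs ≤ occ v r) (++-assoc ps [ u ] vs)
        (least-action-from (legal-++ run-ps (step u-ready done)) psu≤r run v)
      where
      -- Had r fired u no more often than ps, u would be at least as full in c as in the stable c∞.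
      chips-≤ : occ u r ≤ occ u ps → c u ≤ c∞ u
      chips-≤ r≤ps = +-cancelʳ-≤ (suc k * occ u ps) (c u) (c∞ u) (begin
        c u + suc k * occ u ps    ≡⟨ run-balance run-ps u ⟩
        c₀ u + inflow ps u        ≤⟨ +-monoʳ-≤ (c₀ u) (sum-map-mono-occ (λ v → edges v u) ps r ps≤r) ⟩
        c₀ u + inflow r u         ≡⟨ run-balance run-r u ⟨
        c∞ u + suc k * occ u r    ≤⟨ +-monoʳ-≤ (c∞ u) (*-monoʳ-≤ (suc k) r≤ps) ⟩
        c∞ u + suc k * occ u ps   ∎)
        where open ≤-Reasoning

      u-behind : occ u ps < occ u r
      u-behind = ≰⇒> λ r≤ps → <⇒≱ (c∞-stable u) (≤-trans u-ready (chips-≤ r≤ps))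

      psu≤r : ∀ w → occ w (ps ++ [ u ]) ≤ occ w r
      psu≤r w = subst (_≤ occ w r) (sym (occ-snoc ps u w)) (by-cases (u ≟V w))
        where
        by-cases : Dec (u ≡ w) → occ w ps + [ u ≡? w ] ≤ occ w r
        by-cases (yes refl) = subst (λ n → occ u ps + n ≤ occ u r) (sym ([≡?]-refl u))
                                    (subst (_≤ occ u r) (+-comm 1 (occ u ps)) u-behind)
        by-cases (no u≢w)   = subst (λ n → occ w ps + n ≤ occ w r) (sym ([≡?]-≢ u≢w))
                                    (subst (_≤ occ w r) (sym (+-identityʳ (occ w ps))) (ps≤r w))

    least-action : ∀ {c : Config k} {vs} → LegalRun k c₀ vs c → ∀ v → occ v vs ≤ occ v r
    least-action run = least-action-from done (λ _ → z≤n) run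

  stabilizing-runs-agree : ∀ {c₀ c c' : Config k} {r s} →
                           LegalRun k c₀ r c → Stable k c → LegalRun k c₀ s c' → Stable k c' →
                           length s ≡ length r × rootFires s ≡ rootFires r
  stabilizing-runs-agree {r = r} {s} run-r r-stable run-s s-stable =
    ≤-antisym (length-mono-occ s r s≤r) (length-mono-occ r s r≤s) ,
    trans (rootFires≡occ-root s)
      (trans (≤-antisym (s≤r []) (r≤s [])) (sym (rootFires≡occ-root r)))
    where
    s≤r : ∀ v → occ v s ≤ occ v r
    s≤r = least-action run-r r-stable run-s
    r≤s : ∀ v → occ v r ≤ occ v s
    r≤s = least-action run-s s-stable run-r

  legal-independent : ∀ {c : Config k} vs → (∀ w → occ w vs ≤ 1) →
                      (∀ u w → 1 ≤ occ u vs → 1 ≤ occ w vs → u ≢ w → edges u w ≡ 0) →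
                      (∀ w → 1 ≤ occ w vs → suc k ≤ c w) → ∃ λ c' → LegalRun k c vs c'
  legal-independent {c} []       _    _     _     = c , done
  legal-independent {c} (v ∷ vs) once indep ready =
    let c' , run = legal-independent {fire k v c} vs once-vs indep-vs ready-vs
    in  c' , step (ready v (occ-∷-self v vs)) run
    where
    in-tail : ∀ {w} → 1 ≤ occ w vs → 1 ≤ occ w (v ∷ vs)
    in-tail {w} w∈vs = ≤-trans w∈vs (m≤n+m (occ w vs) [ v ≡? w ])
    once-vs : ∀ w → occ w vs ≤ 1
    once-vs w = ≤-trans (m≤n+m (occ w vs) [ v ≡? w ]) (once w)
    indep-vs : ∀ u w → 1 ≤ occ u vs → 1 ≤ occ w vs → u ≢ w → edges u w ≡ 0
    indep-vs u w u∈vs w∈vs = indep u w (in-tail u∈vs) (in-tail w∈vs)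
    ready-vs : ∀ w → 1 ≤ occ w vs → suc k ≤ fire k v c w
    ready-vs w w∈vs = subst (suc k ≤_) (sym (fire-nonadjacent {c} w≢v v-w-nonadjacent)) (ready w (in-tail w∈vs))
      where
      w≢v : w ≢ v
      w≢v refl = <⇒≱ (subst (1 <_) (cong (_+ occ v vs) (sym ([≡?]-refl v))) (s≤s w∈vs)) (once v)
      v-w-nonadjacent : edges v w ≡ 0
      v-w-nonadjacent = indep v w (occ-∷-self v vs) (in-tail w∈vs) (w≢v ∘ sym)

-- Firing whole levels

module _ (k : ℕ) where

  level : ℕ → List (Vertex k)
  level zero    = [ [] ]
  level (suc j) = concatMap (λ i → map (i ∷_) (level j)) (allFin k)

  levels : List ℕ → List (Vertex k)
  levels = concatMap level

  sum-map-level-suc : (f : Vertex k → ℕ) (j : ℕ) →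
    sum (map f (level (suc j))) ≡ sum (map (λ i → sum (map (λ u → f (i ∷ u)) (level j))) (allFin k))
  sum-map-level-suc f j =
    trans (sum-map-concatMap f _ (allFin k)) (sum-map-cong (λ i → cong sum (sym (map-∘ (level j)))) (allFin k))

  occ-level : ∀ j w → occ w (level j) ≡ δ (length w) j
  occ-level zero    []       = refl
  occ-level zero    (_ ∷ _)  = refl
  occ-level (suc j) []       =
    trans (sum-map-level-suc _ j) (sum-map-zero (λ i → sum-map-zero (λ u → refl) (level j)) (allFin k))
  occ-level (suc j) (i₀ ∷ w) = begin
    occ (i₀ ∷ w) (level (suc j))
      ≡⟨ sum-map-level-suc _ j ⟩
    sum (map (λ i → sum (map (λ u → [ i ∷ u ≡? i₀ ∷ w ]) (level j))) (allFin k))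
      ≡⟨ sum-map-allFin-single _ i₀ (λ i i≢i₀ → sum-map-zero (λ u → [≡?]-∷-≢ u w i≢i₀) (level j)) ⟩
    sum (map (λ u → [ i₀ ∷ u ≡? i₀ ∷ w ]) (level j))
      ≡⟨ sum-map-cong (λ u → [≡?]-∷ i₀ u w) (level j) ⟩
    occ w (level j)
      ≡⟨ occ-level j w ⟩
    δ (length w) j
      ∎
    where open ≡-Reasoning

  length-level : ∀ j → length (level j) ≡ k ^ j
  length-level zero    = refl
  length-level (suc j) = begin
    length (level (suc j))                                         ≡⟨ length≡sum-map-1 (level (suc j)) ⟩
    sum (map (λ _ → 1) (level (suc j)))                            ≡⟨ sum-map-level-suc _ j ⟩
    sum (map (λ _ → sum (map (λ _ → 1) (level j))) (allFin k))     ≡⟨ sum-map-const _ (allFin k) ⟩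
    length (allFin k) * sum (map (λ _ → 1) (level j))              ≡⟨ cong₂ _*_ (length-tabulate {n = k} id) (sym (length≡sum-map-1 (level j))) ⟩
    k * length (level j)                                           ≡⟨ cong (k *_) (length-level j) ⟩
    k * k ^ j                                                      ∎
    where open ≡-Reasoning

  -- Chips received by a vertex of level i when level j fires: one from its parent,
  -- one from each of its k children, and one along the root loop.
  levelInflow : ℕ → ℕ → ℕ
  levelInflow j i = δ i (suc j) + k * δ (suc i) j + δ j 0 * δ i 0

  inflow-level : ∀ j w → inflow (level j) w ≡ levelInflow j (length w)
  inflow-level j w = begin
    inflow (level j) w
      ≡⟨ sum-map-+ (λ v → parentIs w v + parentIs v w) (λ v → loopAt v w) (level j) ⟩
    sum (map (λ v → parentIs w v + parentIs v w) (level j)) + sum (map (λ v → loopAt v w) (level j))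
      ≡⟨ cong (_+ sum (map (λ v → loopAt v w) (level j))) (sum-map-+ (λ v → parentIs w v) (λ v → parentIs v w) (level j)) ⟩
    sum (map (λ v → parentIs w v) (level j)) + sum (map (λ v → parentIs v w) (level j))
      + sum (map (λ v → loopAt v w) (level j))
      ≡⟨ cong₂ _+_ (cong₂ _+_ (from-parent w) (from-children j)) (from-root-loop j w) ⟩
    levelInflow j (length w)
      ∎
    where
    open ≡-Reasoning
    from-parent : ∀ w → sum (map (λ v → parentIs w v) (level j)) ≡ δ (length w) (suc j)
    from-parent []      = sum-map-zero (λ _ → refl) (level j)
    from-parent (_ ∷ u) = trans (sum-map-cong ([≡?]-sym u) (level j)) (occ-level j u)
    from-children : ∀ j → sum (map (λ v → parentIs v w) (level j)) ≡ k * δ (suc (length w)) j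
    from-children zero    = sym (*-zeroʳ k)
    from-children (suc j) = begin
      sum (map (λ v → parentIs v w) (level (suc j)))   ≡⟨ sum-map-level-suc _ j ⟩
      sum (map (λ _ → occ w (level j)) (allFin k))     ≡⟨ sum-map-const _ (allFin k) ⟩
      length (allFin k) * occ w (level j)              ≡⟨ cong₂ _*_ (length-tabulate {n = k} id) (occ-level j w) ⟩
      k * δ (length w) j                               ∎
    from-root-loop : ∀ j w → sum (map (λ v → loopAt v w) (level j)) ≡ δ j 0 * δ (length w) 0
    from-root-loop zero    []      = refl
    from-root-loop zero    (_ ∷ _) = refl
    from-root-loop (suc j) w       =
      trans (sum-map-level-suc _ j) (sum-map-zero (λ i → sum-map-zero (λ u → refl) (level j)) (allFin k))

  edges-same-length : {u w : Vertex k} → length u ≡ length w → u ≢ w → edges u w ≡ 0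
  edges-same-length {[]}    {[]}    _       u≢w = ⊥-elim (u≢w refl)
  edges-same-length {i ∷ u} {j ∷ w} |iu|≡|jw| _ =
    cong₂ (λ m n → m + n + 0) ([≡?]-≢ (not-child {w} {u} (sym |u|≡|w|))) ([≡?]-≢ (not-child {u} {w} |u|≡|w|))
    where
    |u|≡|w| : length u ≡ length w
    |u|≡|w| = suc-injective |iu|≡|jw|
    not-child : ∀ {x y : Vertex k} {l} → length x ≡ length y → x ≢ l ∷ y
    not-child |x|≡|y| x≡ly = 1+n≢n (trans (sym (cong length x≡ly)) |x|≡|y|)

  Profile : Set
  Profile = ℕ → ℕ

  HasProfile : Config k → Profile → Set
  HasProfile c L = ∀ w → c w ≡ L (length w)

  fireLevel : ℕ → Profile → Profile
  fireLevel j L i = (L i + levelInflow j i) ∸ suc k * δ i j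

  fireLevel-balance : ∀ {L : Profile} {j} → suc k ≤ L j →
                      ∀ i → fireLevel j L i + suc k * δ i j ≡ L i + levelInflow j i
  fireLevel-balance {L} {j} ready i = m∸n+n≡m (by-cases (i ≟ j))
    where
    by-cases : Dec (i ≡ j) → suc k * δ i j ≤ L i + levelInflow j i
    by-cases (yes refl) = begin
      suc k * δ i i            ≡⟨ cong (suc k *_) (δ-refl i) ⟩
      suc k * 1                ≡⟨ *-identityʳ (suc k) ⟩
      suc k                    ≤⟨ ready ⟩
      L i                      ≤⟨ m≤m+n (L i) _ ⟩
      L i + levelInflow i i    ∎
      where open ≤-Reasoning
    by-cases (no i≢j)   = subst (_≤ L i + levelInflow j i)
                                (sym (trans (cong (suc k *_) (δ-≢ i≢j)) (*-zeroʳ (suc k)))) z≤n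

  level-run : ∀ {c : Config k} {L j} → HasProfile c L → suc k ≤ L j →
              ∃ λ c' → LegalRun k c (level j) c' × HasProfile c' (fireLevel j L)
  level-run {c} {L} {j} c∼L ready =
    let c' , run = legal-independent (level j) once nonadjacent ready-on-level
    in  c' , run , profile run
    where
    on-level : ∀ {w} → 1 ≤ occ w (level j) → length w ≡ j
    on-level {w} w∈ = δ-pos⇒≡ (subst (1 ≤_) (occ-level j w) w∈)
    once : ∀ w → occ w (level j) ≤ 1
    once w = subst (_≤ 1) (sym (occ-level j w)) (δ-≤1 (length w) j)
    nonadjacent : ∀ u w → 1 ≤ occ u (level j) → 1 ≤ occ w (level j) → u ≢ w → edges u w ≡ 0
    nonadjacent u w u∈ w∈ = edges-same-length (trans (on-level u∈) (sym (on-level w∈)))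
    ready-on-level : ∀ w → 1 ≤ occ w (level j) → suc k ≤ c w
    ready-on-level w w∈ = subst (suc k ≤_) (sym (trans (c∼L w) (cong L (on-level w∈)))) ready
    profile : ∀ {c'} → LegalRun k c (level j) c' → HasProfile c' (fireLevel j L)
    profile {c'} run w = +-cancelʳ-≡ (suc k * δ (length w) j) _ _ (begin
      c' w + suc k * δ (length w) j                      ≡⟨ cong (λ n → c' w + suc k * n) (occ-level j w) ⟨
      c' w + suc k * occ w (level j)                     ≡⟨ run-balance run w ⟩
      c w + inflow (level j) w                           ≡⟨ cong₂ _+_ (c∼L w) (inflow-level j w) ⟩
      L (length w) + levelInflow j (length w)            ≡⟨ fireLevel-balance {L} ready (length w) ⟨
      fireLevel j L (length w) + suc k * δ (length w) j  ∎)
      where open ≡-Reasoning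

  data LevelRun : Profile → List ℕ → Profile → Set where
    done : ∀ {L} → LevelRun L [] L
    step : ∀ {L N j js} → suc k ≤ L j → LevelRun (fireLevel j L) js N → LevelRun L (j ∷ js) N

  levelRun-++ : ∀ {L M N xs ys} → LevelRun L xs M → LevelRun M ys N → LevelRun L (xs ++ ys) N
  levelRun-++ done               run  = run
  levelRun-++ (step ready run₁) run₂ = step ready (levelRun-++ run₁ run₂)

  levels-run : ∀ {c : Config k} {L N js} → LevelRun L js N → HasProfile c L →
               ∃ λ c' → LegalRun k c (levels js) c' × HasProfile c' N
  levels-run {c} done c∼L = c , done , c∼L
  levels-run (step ready lrun) c∼L =
    let c₁ , run₁ , c₁∼L₁ = level-run c∼L ready
        c₂ , run₂ , c₂∼N  = levels-run lrun c₁∼L₁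
    in  c₂ , legal-++ run₁ run₂ , c₂∼N

  -- Waves

  wave : ℕ → List ℕ
  wave n = upTo (suc n)

  waves : ℕ → List ℕ
  waves n = concatMap wave (downFrom n)

  -- Levels 1, …, n receive a chip from the level above before they fire, so k chips suffice there.
  WaveReady : ℕ → Profile → Set
  WaveReady n L = suc k ≤ L 0 × (∀ i → i < n → k ≤ L (suc i))

  WaveEffect : ℕ → Profile → Profile → Set
  WaveEffect n L N = ∀ i → N i + k * δ i n ≡ L i + δ i (suc n)

  wave-untouched : ∀ {n L N} → WaveEffect n L N → ∀ {i} → i < n → N i ≡ L i
  wave-untouched {n} {L} {N} effect {i} i<n = begin
    N i                   ≡⟨ +-identityʳ (N i) ⟨
    N i + 0               ≡⟨ cong (N i +_) (*-zeroʳ k) ⟨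
    N i + k * 0           ≡⟨ cong (λ d → N i + k * d) (δ-≢ (<⇒≢ i<n)) ⟨
    N i + k * δ i n       ≡⟨ effect i ⟩
    L i + δ i (suc n)     ≡⟨ cong (L i +_) (δ-≢ (<⇒≢ (m<n⇒m<1+n i<n))) ⟩
    L i + 0               ≡⟨ +-identityʳ (L i) ⟩
    L i                   ∎
    where open ≡-Reasoning

  wave-top : ∀ {n L N} → WaveEffect n L N → N (suc n) ≡ suc (L (suc n))
  wave-top {n} {L} {N} effect = begin
    N (suc n)                       ≡⟨ +-identityʳ (N (suc n)) ⟨
    N (suc n) + 0                   ≡⟨ cong (N (suc n) +_) (*-zeroʳ k) ⟨
    N (suc n) + k * 0               ≡⟨ cong (λ d → N (suc n) + k * d) (δ-≢ (1+n≢n {n})) ⟨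
    N (suc n) + k * δ (suc n) n     ≡⟨ effect (suc n) ⟩
    L (suc n) + δ (suc n) (suc n)   ≡⟨ cong (L (suc n) +_) (δ-refl n) ⟩
    L (suc n) + 1                   ≡⟨ +-comm (L (suc n)) 1 ⟩
    suc (L (suc n))                 ∎
    where open ≡-Reasoning

  wave-run : ∀ n {L} → WaveReady n L → ∃ λ N → LevelRun L (wave n) N × WaveEffect n L N
  wave-run zero {L} (ready₀ , _) = fireLevel 0 L , step ready₀ done , effect
    where
    effect : WaveEffect 0 L (fireLevel 0 L)
    effect i = +-cancelʳ-≡ (δ i 0) _ _ (begin
      fireLevel 0 L i + k * δ i 0 + δ i 0          ≡⟨ xy∙z≈x∙zy (fireLevel 0 L i) (k * δ i 0) (δ i 0) ⟩
      fireLevel 0 L i + suc k * δ i 0              ≡⟨ fireLevel-balance {L} ready₀ i ⟩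
      L i + (δ i 1 + k * 0 + (δ i 0 + 0))          ≡⟨ cong (λ x → L i + (δ i 1 + x + (δ i 0 + 0))) (*-zeroʳ k) ⟩
      L i + (δ i 1 + 0 + (δ i 0 + 0))              ≡⟨ cong (L i +_) (cong₂ _+_ (+-identityʳ (δ i 1)) (+-identityʳ (δ i 0))) ⟩
      L i + (δ i 1 + δ i 0)                        ≡⟨ +-assoc (L i) (δ i 1) (δ i 0) ⟨
      L i + δ i 1 + δ i 0                          ∎)
      where open ≡-Reasoning
  wave-run (suc n) {L} (ready₀ , ready) =
    let N₁ , run₁ , effect₁ = wave-run n (ready₀ , λ i i<n → ready i (m<n⇒m<1+n i<n))
        top-ready = subst (suc k ≤_) (sym (wave-top effect₁)) (s≤s (ready n ≤-refl))
    in  fireLevel (suc n) N₁ ,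
        subst (λ js → LevelRun L js (fireLevel (suc n) N₁)) (upTo-∷ʳ (suc n))
              (levelRun-++ run₁ (step top-ready done)) ,
        effect top-ready effect₁
    where
    effect : ∀ {N₁} → suc k ≤ N₁ (suc n) → WaveEffect n L N₁ → WaveEffect (suc n) L (fireLevel (suc n) N₁)
    effect {N₁} top-ready effect₁ i = +-cancelʳ-≡ δ₁ _ _ (begin
      fireLevel (suc n) N₁ i + k * δ₁ + δ₁    ≡⟨ xy∙z≈x∙zy (fireLevel (suc n) N₁ i) (k * δ₁) δ₁ ⟩
      fireLevel (suc n) N₁ i + suc k * δ₁     ≡⟨ fireLevel-balance {N₁} top-ready i ⟩
      N₁ i + (δ₂ + k * δ₀ + 0)                ≡⟨ cong (N₁ i +_) (+-identityʳ (δ₂ + k * δ₀)) ⟩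
      N₁ i + (δ₂ + k * δ₀)                    ≡⟨ x∙yz≈xz∙y (N₁ i) δ₂ (k * δ₀) ⟩
      N₁ i + k * δ₀ + δ₂                      ≡⟨ cong (_+ δ₂) (effect₁ i) ⟩
      L i + δ₁ + δ₂                           ≡⟨ xy∙z≈xz∙y (L i) δ₁ δ₂ ⟩
      L i + δ₂ + δ₁                           ∎)
      where
      open ≡-Reasoning
      δ₀ δ₁ δ₂ : ℕ
      δ₀ = δ i n
      δ₁ = δ i (suc n)
      δ₂ = δ i (suc (suc n))

  WavesEffect : ℕ → Profile → Profile → Set
  WavesEffect n L N = ∀ i → N i + k * below i n ≡ L i + parentBelow i n

  waves-run : ∀ n {L} → WaveReady n L → ∃ λ N → LevelRun L (waves (suc n)) N × WavesEffect (suc n) L N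
  waves-run zero {L} ready =
    let N , run , effect = wave-run 0 ready
    in  N , levelRun-++ run done ,
        λ i → trans (cong (λ x → N i + k * x) (below-one i)) (trans (effect i) (cong (L i +_) (sym (parentBelow-one i))))
    where
    below-one : ∀ i → below i 1 ≡ δ i 0
    below-one zero    = refl
    below-one (suc i) = refl
    parentBelow-one : ∀ i → parentBelow i 1 ≡ δ i 1
    parentBelow-one zero          = refl
    parentBelow-one (suc zero)    = refl
    parentBelow-one (suc (suc i)) = refl
  waves-run (suc n) {L} (ready₀ , ready) =
    let N₁ , run₁ , effect₁ = wave-run (suc n) (ready₀ , ready)
        N₂ , run₂ , effect₂ = waves-run n (subst (suc k ≤_) (sym (wave-untouched effect₁ (s≤s z≤n))) ready₀ ,
                                           λ i i<n → subst (k ≤_) (sym (wave-untouched effect₁ (s≤s i<n)))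
                                                           (ready i (m<n⇒m<1+n i<n)))
    in  N₂ , levelRun-++ run₁ run₂ , effect effect₁ effect₂
    where
    effect : ∀ {N₁ N₂} → WaveEffect (suc n) L N₁ → WavesEffect (suc n) N₁ N₂ → WavesEffect (suc (suc n)) L N₂
    effect {N₁} {N₂} effect₁ effect₂ i = begin
      N₂ i + k * below i (suc (suc n))    ≡⟨ cong (λ x → N₂ i + k * x) (below-suc i (suc n)) ⟩
      N₂ i + k * (bₙ + δ₁)                ≡⟨ cong (N₂ i +_) (*-distribˡ-+ k bₙ δ₁) ⟩
      N₂ i + (k * bₙ + k * δ₁)            ≡⟨ +-assoc (N₂ i) (k * bₙ) (k * δ₁) ⟨
      N₂ i + k * bₙ + k * δ₁              ≡⟨ cong (_+ k * δ₁) (effect₂ i) ⟩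
      N₁ i + pₙ + k * δ₁                  ≡⟨ xy∙z≈xz∙y (N₁ i) pₙ (k * δ₁) ⟩
      N₁ i + k * δ₁ + pₙ                  ≡⟨ cong (_+ pₙ) (effect₁ i) ⟩
      L i + δ₂ + pₙ                       ≡⟨ xy∙z≈x∙zy (L i) δ₂ pₙ ⟩
      L i + (pₙ + δ₂)                     ≡⟨ cong (L i +_) (parentBelow-suc i (suc n)) ⟨
      L i + parentBelow i (suc (suc n))   ∎
      where
      open ≡-Reasoning
      bₙ pₙ δ₁ δ₂ : ℕ
      bₙ = below i (suc n)
      pₙ = parentBelow i (suc n)
      δ₁ = δ i (suc n)
      δ₂ = δ i (suc (suc n))

  -- Stabilizing (m + 1)k chips

  -- Bijective base-k numerals, least significant digit first: the digits lie in 1, …, k.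
  increment : List ℕ → List ℕ
  increment []       = [ 1 ]
  increment (d ∷ ds) with d ≟ k
  ... | yes _ = 1 ∷ increment ds
  ... | no  _ = suc d ∷ ds

  rollovers : List ℕ → ℕ
  rollovers []       = 0
  rollovers (d ∷ ds) with d ≟ k
  ... | yes _ = suc (rollovers ds)
  ... | no  _ = 0

  digits : ℕ → List ℕ
  digits zero    = []
  digits (suc m) = increment (digits m)

  digitProfile : List ℕ → Profile
  digitProfile _        zero          = k
  digitProfile []       (suc _)       = 0
  digitProfile (d ∷ _)  (suc zero)    = d
  digitProfile (_ ∷ ds) (suc (suc i)) = digitProfile ds (suc i)

  rootProfile : ℕ → Profile
  rootProfile N zero    = N
  rootProfile N (suc _) = 0

  initial-profile : ∀ N → HasProfile (initial k N) (rootProfile N)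
  initial-profile N []      = refl
  initial-profile N (_ ∷ _) = refl

  increment-≤ : 1 ≤ k → ∀ {ds} → All (_≤ k) ds → All (_≤ k) (increment ds)
  increment-≤ k≥1 []                      = k≥1 ∷ []
  increment-≤ k≥1 {d ∷ ds} (d≤k ∷ ds≤k) with d ≟ k
  ... | yes _   = k≥1 ∷ increment-≤ k≥1 ds≤k
  ... | no d≢k = ≤∧≢⇒< d≤k d≢k ∷ ds≤k

  digits-≤ : 1 ≤ k → ∀ m → All (_≤ k) (digits m)
  digits-≤ k≥1 zero    = []
  digits-≤ k≥1 (suc m) = increment-≤ k≥1 (digits-≤ k≥1 m)

  digitProfile-≤ : ∀ {ds} → All (_≤ k) ds → ∀ i → digitProfile ds i ≤ k
  digitProfile-≤ _            zero          = ≤-refl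
  digitProfile-≤ []           (suc _)       = z≤n
  digitProfile-≤ (d≤k ∷ _)    (suc zero)    = d≤k
  digitProfile-≤ (_ ∷ ds≤k)   (suc (suc i)) = digitProfile-≤ ds≤k (suc i)

  rollovers-full : ∀ ds {i} → i < rollovers ds → digitProfile ds (suc i) ≡ k
  rollovers-full (d ∷ ds) {i} i<r with d ≟ k
  rollovers-full (d ∷ ds) {zero}  _         | yes refl = refl
  rollovers-full (d ∷ ds) {suc i} (s≤s i<r) | yes refl = rollovers-full ds i<r
  rollovers-full (d ∷ ds) {i}     ()        | no _

  increment-profile : ∀ ds i →
    digitProfile (increment ds) i + k * below i (suc (rollovers ds))
      ≡ digitProfile ds i + rootProfile k i + parentBelow i (suc (rollovers ds))
  increment-profile ds       zero          = trans (cong (k +_) (*-identityʳ k)) (sym (+-identityʳ (k + k)))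
  increment-profile []       (suc zero)    = cong suc (*-zeroʳ k)
  increment-profile []       (suc (suc i)) = *-zeroʳ k
  increment-profile (d ∷ ds) (suc i) with d ≟ k
  increment-profile (d ∷ ds) (suc zero)    | yes refl =
    trans (cong suc (*-identityʳ k)) (sym (trans (cong (_+ 1) (+-identityʳ k)) (+-comm k 1)))
  increment-profile (d ∷ ds) (suc (suc i)) | yes refl = increment-profile ds (suc i)
  increment-profile (d ∷ ds) (suc zero)    | no _     =
    trans (cong (suc d +_) (*-zeroʳ k)) (trans (+-identityʳ (suc d)) (sym (trans (cong (_+ 1) (+-identityʳ d)) (+-comm d 1))))
  increment-profile (d ∷ ds) (suc (suc i)) | no _     =
    trans (cong (digitProfile ds (suc i) +_) (*-zeroʳ k)) (sym (+-identityʳ _))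

  profile-stable : ∀ {c : Config k} {L} → HasProfile c L → (∀ i → L i ≤ k) → Stable k c
  profile-stable c∼L L≤k v = s≤s (subst (_≤ k) (sym (c∼L v)) (L≤k (length v)))

  increment-run : 1 ≤ k → ∀ {m r c ds} →
    LegalRun k (initial k (suc m * k)) r c → HasProfile c (digitProfile ds) →
    ∃ λ c' → LegalRun k (initial k (suc (suc m) * k)) (r ++ levels (waves (suc (rollovers ds)))) c'
           × HasProfile c' (digitProfile (increment ds))
  increment-run k≥1 {m} {ds = ds} run c∼ds =
    let d , run⁺ , d≗c+k    = legal-+ run add-k
        N , lrun , effect    = waves-run (rollovers ds) ready
        c' , run-waves , c'∼N = levels-run lrun (λ w → trans (d≗c+k w) (cong₂ _+_ (c∼ds w) (initial-profile k w)))
    in  c' , legal-++ run⁺ run-waves , λ w → trans (c'∼N w) (final effect (length w))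
    where
    X : Profile
    X i = digitProfile ds i + rootProfile k i
    add-k : ∀ w → initial k (suc (suc m) * k) w ≡ initial k (suc m * k) w + initial k k w
    add-k []      = +-comm k (suc m * k)
    add-k (_ ∷ _) = refl
    ready : WaveReady (rollovers ds) X
    ready = m<m+n k k≥1 ,
            λ i i<r → subst (λ x → k ≤ x + 0) (sym (rollovers-full ds i<r)) (m≤m+n k 0)
    final : ∀ {N} → WavesEffect (suc (rollovers ds)) X N → ∀ i → N i ≡ digitProfile (increment ds) i
    final effect i = +-cancelʳ-≡ _ _ _ (trans (effect i) (sym (increment-profile ds i)))

  stabilization : 1 ≤ k → ∀ m →
    ∃₂ λ r c → LegalRun k (initial k (suc m * k)) r c × HasProfile c (digitProfile (digits m))
  stabilization _   zero    = [] , initial k (1 * k) , done , root-only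
    where
    root-only : HasProfile (initial k (1 * k)) (digitProfile [])
    root-only []      = +-identityʳ k
    root-only (_ ∷ _) = refl
  stabilization k≥1 (suc m) =
    let r , c , run , c∼ds = stabilization k≥1 m
        c' , run' , c'∼ds' = increment-run k≥1 {m} run c∼ds
    in  r ++ levels (waves (suc (rollovers (digits m)))) , c' , run' , c'∼ds'

  -- Counting fires

  geom : ℕ → ℕ
  geom zero    = 1
  geom (suc n) = geom n + k ^ suc n

  k*geom+1 : ∀ n → k * geom n + 1 ≡ geom (suc n)
  k*geom+1 zero    = +-comm (k * 1) 1
  k*geom+1 (suc n) = begin
    k * (geom n + k ^ suc n) + 1         ≡⟨ cong (_+ 1) (*-distribˡ-+ k (geom n) (k ^ suc n)) ⟩
    k * geom n + k ^ suc (suc n) + 1     ≡⟨ xy∙z≈xz∙y (k * geom n) (k ^ suc (suc n)) 1 ⟩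
    k * geom n + 1 + k ^ suc (suc n)     ≡⟨ cong (_+ k ^ suc (suc n)) (k*geom+1 n) ⟩
    geom (suc n) + k ^ suc (suc n)       ∎
    where open ≡-Reasoning

  a-suc : ∀ n → a (suc n) k ≡ geom n + a n k
  a-suc zero    = cong (_+ 1) (*-zeroʳ k)
  a-suc (suc n) = begin
    k * a (suc n) k + suc (suc n)               ≡⟨ cong (λ x → k * x + suc (suc n)) (a-suc n) ⟩
    k * (geom n + a n k) + suc (suc n)          ≡⟨ regroup k (geom n) (a n k) n ⟩
    (k * geom n + 1) + (k * a n k + suc n)      ≡⟨ cong (_+ a (suc n) k) (k*geom+1 n) ⟩
    geom (suc n) + a (suc n) k                  ∎
    where
    open ≡-Reasoning
    regroup : ∀ k g x n → k * (g + x) + suc (suc n) ≡ (k * g + 1) + (k * x + suc n)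
    regroup = solve-∀

  sum-map-wave-suc : (f : ℕ → ℕ) (n : ℕ) → sum (map f (wave (suc n))) ≡ sum (map f (wave n)) + f (suc n)
  sum-map-wave-suc f n = begin
    sum (map f (wave (suc n)))              ≡⟨ cong (sum ∘ map f) (upTo-∷ʳ (suc n)) ⟨
    sum (map f (wave n ++ [ suc n ]))       ≡⟨ sum-map-++ f (wave n) [ suc n ] ⟩
    sum (map f (wave n)) + (f (suc n) + 0)  ≡⟨ cong (sum (map f (wave n)) +_) (+-identityʳ (f (suc n))) ⟩
    sum (map f (wave n)) + f (suc n)        ∎
    where open ≡-Reasoning

  length-levels : ∀ js → length (levels js) ≡ sum (map (k ^_) js)
  length-levels []       = refl
  length-levels (j ∷ js) = trans (length-++ (level j)) (cong₂ _+_ (length-level j) (length-levels js))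

  rootFires-levels : ∀ js → rootFires (levels js) ≡ sum (map (δ 0) js)
  rootFires-levels js =
    trans (rootFires≡occ-root (levels js))
          (trans (sum-map-concatMap _ level js) (sum-map-cong (λ j → occ-level j []) js))

  length-waves : ∀ n → length (levels (waves n)) ≡ a n k
  length-waves n = trans (length-levels (waves n)) (sum-pow-waves n)
    where
    sum-pow-wave : ∀ n → sum (map (k ^_) (wave n)) ≡ geom n
    sum-pow-wave zero    = refl
    sum-pow-wave (suc n) = trans (sum-map-wave-suc (k ^_) n) (cong (_+ k ^ suc n) (sum-pow-wave n))
    sum-pow-waves : ∀ n → sum (map (k ^_) (waves n)) ≡ a n k
    sum-pow-waves zero    = refl
    sum-pow-waves (suc n) =
      trans (sum-map-++ (k ^_) (wave n) (waves n))
            (trans (cong₂ _+_ (sum-pow-wave n) (sum-pow-waves n)) (sym (a-suc n)))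

  rootFires-waves : ∀ n → rootFires (levels (waves n)) ≡ n
  rootFires-waves n = trans (rootFires-levels (waves n)) (roots-waves n)
    where
    roots-wave : ∀ n → sum (map (δ 0) (wave n)) ≡ 1
    roots-wave zero    = refl
    roots-wave (suc n) = trans (sum-map-wave-suc (δ 0) n) (cong (_+ 0) (roots-wave n))
    roots-waves : ∀ n → sum (map (δ 0) (waves n)) ≡ n
    roots-waves zero    = refl
    roots-waves (suc n) =
      trans (sum-map-++ (δ 0) (wave n) (waves n)) (cong₂ _+_ (roots-wave n) (roots-waves n))

  consecutive-stabilizations : 1 ≤ k → ∀ m → ∃₂ λ r c → ∃ λ c' →
    (LegalRun k (initial k (suc m * k)) r c × Stable k c) ×
    (LegalRun k (initial k (suc (suc m) * k)) (r ++ levels (waves (suc (rollovers (digits m))))) c' × Stable k c')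
  consecutive-stabilizations k≥1 m =
    let r , c , run , c∼ds = stabilization k≥1 m
        c' , run' , c'∼ds' = increment-run k≥1 {m} run c∼ds
    in  r , c , c' ,
        (run , profile-stable c∼ds (digitProfile-≤ (digits-≤ k≥1 m))) ,
        (run' , profile-stable c'∼ds' (digitProfile-≤ (digits-≤ k≥1 (suc m))))

mainTheorem17 : (k : ℕ) → 2 ≤ k → (m : ℕ) → 1 ≤ m →
    (s t : List (Vertex k)) (c c' : Config k) →
    LegalRun k (initial k (m * k)) s c → Stable k c →
    LegalRun k (initial k (suc m * k)) t c' → Stable k c' →
    length t ≡ length s + a (rootFires t ∸ rootFires s) k
mainTheorem17 k k≥2 (suc m) _ s t c c' run-s s-stable run-t t-stable
  with consecutive-stabilizations k (≤-trans (s≤s z≤n) k≥2) m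
... | r , _ , _ , (run-r , r-stable) , (run-rw , rw-stable)
  with stabilizing-runs-agree run-r r-stable run-s s-stable
     | stabilizing-runs-agree run-rw rw-stable run-t t-stable
... | |s|≡|r| , roots-s | |t|≡|rw| , roots-t = begin
    length t                                       ≡⟨ |t|≡|rw| ⟩
    length (r ++ w)                                ≡⟨ length-++ r ⟩
    length r + length w                            ≡⟨ cong₂ _+_ (sym |s|≡|r|) (length-waves k n) ⟩
    length s + a n k                               ≡⟨ cong (λ d → length s + a d k) d₀≡n ⟨
    length s + a (rootFires t ∸ rootFires s) k     ∎
  where
  open ≡-Reasoning
  n : ℕ
  n = suc (rollovers k (digits k m))
  w : List (Vertex k)
  w = levels k (waves k n)
  d₀≡n : rootFires t ∸ rootFires s ≡ n
  d₀≡n = begin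
    rootFires t ∸ rootFires s                    ≡⟨ cong₂ _∸_ (trans roots-t (rootFires-++ r w)) roots-s ⟩
    (rootFires r + rootFires w) ∸ rootFires r    ≡⟨ m+n∸m≡n (rootFires r) (rootFires w) ⟩
    rootFires w                                  ≡⟨ rootFires-waves k n ⟩
    n                                            ∎
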